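{- Let $A$ be an h-lattice. Then $A$ is a subresiduated lattice if and only if $\mathrm{K}(A)$ is a subresiduated Nelson algebra.
   Context: An h-lattice is an algebra $\langle A,\wedge,\vee,\rightarrow,0,1\rangle$ of type $(2,2,2,0,0)$ such that $\langle A,\wedge,\vee,0,1\rangle$ is a bounded distributive lattice, $a\rightarrow a=1$ and $a\wedge(a\rightarrow b)\le b$ for all $a,b$. For an h-lattice $A$, $\mathrm{K}(A)=\{(a,b)\in A\times A: a\wedge b=0\}$ with operations $(a,b)\wedge(c,d)=(a\wedge c,b\vee d)$, $(a,b)\vee(c,d)=(a\vee c,b\wedge d)$, $\sim(a,b)=(b,a)$, $(a,b)\rightarrow(c,d)=(a\rightarrow c,a\wedge d)$, constants $0=(0,1)$, $1=(1,0)$. A subresiduated lattice is (equivalently) an algebra $\langle A,\wedge,\vee,\rightarrow,0,1\rangle$ such that $\langle A,\wedge,\vee,0,1\rangle$ is a bounded distributive lattice and for all $a,b,c$: $(a\vee b)\rightarrow c=(a\rightarrow c)\wedge(b\rightarrow c)$; $c\rightarrow(a\wedge b)=(c\rightarrow a)\wedge(c\rightarrow b)$; $(a\rightarrow b)\wedge(b\rightarrow c)\le a\rightarrow c$; $a\rightarrow a=1$; $a\wedge(a\rightarrow b)\le b$; $a\rightarrow b\le c\rightarrow(a\rightarrow b)$. A Kleene algebra is a bounded distributive lattice with a unary operation $\sim$ such that $\sim\sim x=x$, $\sim(x\wedge y)=\sim x\vee\sim y$ and $(x\wedge\sim x)\wedge(y\vee\sim y)=x\wedge\sim x$. A subresiduated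 Nelson algebra is an algebra $\langle T,\wedge,\vee,\rightarrow,\sim,0,1\rangle$ such that $\langle T,\wedge,\vee,\sim,0,1\rangle$ is a Kleene algebra and for all $x,y,z$: (1) $(x\vee y)\rightarrow z=(x\rightarrow z)\wedge(y\rightarrow z)$; (2) $z\rightarrow(x\wedge y)=(z\rightarrow x)\wedge(z\rightarrow y)$; (3) $((x\rightarrow y)\wedge(y\rightarrow z))\rightarrow(x\rightarrow z)=1$; (4) $x\rightarrow x=1$; (5) $x\wedge(x\rightarrow y)\le x\wedge(\sim x\vee y)$; (6) $x\rightarrow y\le z\rightarrow(x\rightarrow y)$; (7) $\sim(x\rightarrow y)\rightarrow(x\wedge\sim y)=1$; (8) $(x\wedge\sim y)\rightarrow\sim(x\rightarrow y)=1$. -}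

module Defs where

open import Level using (Level; _⊔_)
open import Data.Product using (Σ; _×_; _,_; proj₁; proj₂)
open import Relation.Binary.Core using (Rel)
open import Relation.Binary.PropositionalEquality
  using (_≡_; refl; sym; trans; cong; cong₂; module ≡-Reasoning)
open import Algebra.Core using (Op₁; Op₂)
import Algebra.Definitions as AD
open import Algebra.Lattice.Structures using (IsDistributiveLattice)

-- Generic notions over a carrier with an equality relation _≈_.
-- The lattice order is  x ≤ y  :⇔  x ∧ y ≈ x.

module _ {a ℓ : Level} {A : Set a} (_≈_ : Rel A ℓ) where

  record IsBDL (_∧_ _∨_ : Op₂ A) (𝟎 𝟏 : A) : Set (a ⊔ ℓ) where
    field
      isDistributiveLattice : IsDistributiveLattice _≈_ _∨_ _∧_
      ∨-identity : AD.Identity _≈_ 𝟎 _∨_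
      ∧-identity : AD.Identity _≈_ 𝟏 _∧_

  record IsHLattice (_∧_ _∨_ _⇒_ : Op₂ A) (𝟎 𝟏 : A) : Set (a ⊔ ℓ) where
    field
      isBDL  : IsBDL _∧_ _∨_ 𝟎 𝟏
      ⇒-refl : ∀ x → (x ⇒ x) ≈ 𝟏
      ⇒-mp   : ∀ x y → ((x ∧ (x ⇒ y)) ∧ y) ≈ (x ∧ (x ⇒ y))

  record IsSubresiduatedLattice (_∧_ _∨_ _⇒_ : Op₂ A) (𝟎 𝟏 : A) : Set (a ⊔ ℓ) where
    field
      isBDL  : IsBDL _∧_ _∨_ 𝟎 𝟏
      ax1 : ∀ x y z → ((x ∨ y) ⇒ z) ≈ ((x ⇒ z) ∧ (y ⇒ z))
      ax2 : ∀ x y z → (z ⇒ (x ∧ y)) ≈ ((z ⇒ x) ∧ (z ⇒ y))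
      ax3 : ∀ x y z → (((x ⇒ y) ∧ (y ⇒ z)) ∧ (x ⇒ z)) ≈ ((x ⇒ y) ∧ (y ⇒ z))
      ax4 : ∀ x → (x ⇒ x) ≈ 𝟏
      ax5 : ∀ x y → ((x ∧ (x ⇒ y)) ∧ y) ≈ (x ∧ (x ⇒ y))
      ax6 : ∀ x y z → ((x ⇒ y) ∧ (z ⇒ (x ⇒ y))) ≈ (x ⇒ y)

  record IsKleene (_∧_ _∨_ : Op₂ A) (∼ : Op₁ A) (𝟎 𝟏 : A) : Set (a ⊔ ℓ) where
    field
      isBDL     : IsBDL _∧_ _∨_ 𝟎 𝟏
      ∼-invol   : ∀ x → ∼ (∼ x) ≈ x
      ∼-deMorgan : ∀ x y → ∼ (x ∧ y) ≈ (∼ x ∨ ∼ y)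
      kleene    : ∀ x y → ((x ∧ ∼ x) ∧ (y ∨ ∼ y)) ≈ (x ∧ ∼ x)

  record IsSRN (_∧_ _∨_ _⇒_ : Op₂ A) (∼ : Op₁ A) (𝟎 𝟏 : A) : Set (a ⊔ ℓ) where
    field
      isKleene : IsKleene _∧_ _∨_ ∼ 𝟎 𝟏
      n1 : ∀ x y z → ((x ∨ y) ⇒ z) ≈ ((x ⇒ z) ∧ (y ⇒ z))
      n2 : ∀ x y z → (z ⇒ (x ∧ y)) ≈ ((z ⇒ x) ∧ (z ⇒ y))
      n3 : ∀ x y z → (((x ⇒ y) ∧ (y ⇒ z)) ⇒ (x ⇒ z)) ≈ 𝟏
      n4 : ∀ x → (x ⇒ x) ≈ 𝟏
      n5 : ∀ x y → ((x ∧ (x ⇒ y)) ∧ (x ∧ (∼ x ∨ y))) ≈ (x ∧ (x ⇒ y))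
      n6 : ∀ x y z → ((x ⇒ y) ∧ (z ⇒ (x ⇒ y))) ≈ (x ⇒ y)
      n7 : ∀ x y → (∼ (x ⇒ y) ⇒ (x ∧ ∼ y)) ≈ 𝟏
      n8 : ∀ x y → ((x ∧ ∼ y) ⇒ ∼ (x ⇒ y)) ≈ 𝟏

module K {a : Level} {A : Set a} {_∧_ _∨_ _⇒_ : Op₂ A} {𝟎 𝟏 : A}
         (H : IsHLattice _≡_ _∧_ _∨_ _⇒_ 𝟎 𝟏) where

  open IsHLattice H
  open IsBDL isBDL
  open IsDistributiveLattice isDistributiveLattice hiding (sym; trans; refl)
  open ≡-Reasoning

  Carrier : Set a
  Carrier = Σ (A × A) λ p → (proj₁ p ∧ proj₂ p) ≡ 𝟎

  _≈_ : Rel Carrier a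
  ((x , y) , _) ≈ ((u , v) , _) = (x ≡ u) × (y ≡ v)

  private
    0∧ : ∀ x → (𝟎 ∧ x) ≡ 𝟎
    0∧ x = begin
      𝟎 ∧ x             ≡⟨ cong (𝟎 ∧_) (sym (proj₁ ∨-identity x)) ⟩
      𝟎 ∧ (𝟎 ∨ x)       ≡⟨ ∧-absorbs-∨ 𝟎 x ⟩
      𝟎 ∎

    ∧0 : ∀ x → (x ∧ 𝟎) ≡ 𝟎
    ∧0 x = trans (∧-comm x 𝟎) (0∧ x)

  𝟎K : Carrier
  𝟎K = (𝟎 , 𝟏) , proj₂ ∧-identity 𝟎

  𝟏K : Carrier
  𝟏K = (𝟏 , 𝟎) , proj₁ ∧-identity 𝟎

  ∼K : Op₁ Carrier
  ∼K ((x , y) , p) = (y , x) , trans (∧-comm y x) p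

  _∧K_ : Op₂ Carrier
  ((x , y) , p) ∧K ((u , v) , q) = ((x ∧ u) , (y ∨ v)) , pf
    where
    pf : ((x ∧ u) ∧ (y ∨ v)) ≡ 𝟎
    pf = begin
      (x ∧ u) ∧ (y ∨ v)                 ≡⟨ ∧-distribˡ-∨ (x ∧ u) y v ⟩
      ((x ∧ u) ∧ y) ∨ ((x ∧ u) ∧ v)     ≡⟨ cong₂ _∨_ e1 e2 ⟩
      𝟎 ∨ 𝟎                             ≡⟨ proj₁ ∨-identity 𝟎 ⟩
      𝟎 ∎
      where
      e1 : ((x ∧ u) ∧ y) ≡ 𝟎
      e1 = begin
        (x ∧ u) ∧ y   ≡⟨ ∧-assoc x u y ⟩
        x ∧ (u ∧ y)   ≡⟨ cong (x ∧_) (∧-comm u y) ⟩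
        x ∧ (y ∧ u)   ≡⟨ sym (∧-assoc x y u) ⟩
        (x ∧ y) ∧ u   ≡⟨ cong (_∧ u) p ⟩
        𝟎 ∧ u         ≡⟨ 0∧ u ⟩
        𝟎 ∎
      e2 : ((x ∧ u) ∧ v) ≡ 𝟎
      e2 = begin
        (x ∧ u) ∧ v   ≡⟨ ∧-assoc x u v ⟩
        x ∧ (u ∧ v)   ≡⟨ cong (x ∧_) q ⟩
        x ∧ 𝟎         ≡⟨ ∧0 x ⟩
        𝟎 ∎

  _∨K_ : Op₂ Carrier
  ((x , y) , p) ∨K ((u , v) , q) = ((x ∨ u) , (y ∧ v)) , pf
    where
    pf : ((x ∨ u) ∧ (y ∧ v)) ≡ 𝟎
    pf = begin
      (x ∨ u) ∧ (y ∧ v)                 ≡⟨ ∧-distribʳ-∨ (y ∧ v) x u ⟩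
      (x ∧ (y ∧ v)) ∨ (u ∧ (y ∧ v))     ≡⟨ cong₂ _∨_ e1 e2 ⟩
      𝟎 ∨ 𝟎                             ≡⟨ proj₁ ∨-identity 𝟎 ⟩
      𝟎 ∎
      where
      e1 : (x ∧ (y ∧ v)) ≡ 𝟎
      e1 = begin
        x ∧ (y ∧ v)   ≡⟨ sym (∧-assoc x y v) ⟩
        (x ∧ y) ∧ v   ≡⟨ cong (_∧ v) p ⟩
        𝟎 ∧ v         ≡⟨ 0∧ v ⟩
        𝟎 ∎
      e2 : (u ∧ (y ∧ v)) ≡ 𝟎
      e2 = begin
        u ∧ (y ∧ v)   ≡⟨ cong (u ∧_) (∧-comm y v) ⟩
        u ∧ (v ∧ y)   ≡⟨ sym (∧-assoc u v y) ⟩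
        (u ∧ v) ∧ y   ≡⟨ cong (_∧ y) q ⟩
        𝟎 ∧ y         ≡⟨ 0∧ y ⟩
        𝟎 ∎

  _⇒K_ : Op₂ Carrier
  ((x , y) , p) ⇒K ((u , v) , q) = ((x ⇒ u) , (x ∧ v)) , pf
    where
    w = x ∧ (x ⇒ u)
    pf : ((x ⇒ u) ∧ (x ∧ v)) ≡ 𝟎
    pf = begin
      (x ⇒ u) ∧ (x ∧ v)   ≡⟨ sym (∧-assoc (x ⇒ u) x v) ⟩
      ((x ⇒ u) ∧ x) ∧ v   ≡⟨ cong (_∧ v) (∧-comm (x ⇒ u) x) ⟩
      w ∧ v               ≡⟨ cong (_∧ v) (sym (⇒-mp x u)) ⟩
      (w ∧ u) ∧ v         ≡⟨ ∧-assoc w u v ⟩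
      w ∧ (u ∧ v)         ≡⟨ cong (w ∧_) q ⟩
      w ∧ 𝟎               ≡⟨ ∧0 w ⟩
      𝟎 ∎

{-# OPTIONS --safe #-}
-- In K(A) the first coordinates of ∧, ∨ and → are computed in A alone, while
-- the second coordinate of every subresiduated Nelson axiom holds in any
-- h-lattice, by modus ponens x ∧ (x → y) ≤ y and the disjointness a ∧ b = 0 of
-- the coordinates of (a , b) ∈ K(A).  So K(A) satisfies the axioms exactly when
-- their first coordinates hold in A, and these are the subresiduated axioms once
-- axiom (3) is read through x ≤ y ⇔ x → y = 1.  Conversely, evaluating the
-- axioms of K(A) at the elements (x , 0) yields those of A.
module Submission where

open import Defs
open import Level using (Level)
open import Relation.Binary.PropositionalEquality using (_≡_)
open import Algebra.Core using (Op₂)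
open import Function.Bundles using (_⇔_)

open import Data.Product using (_,_; proj₁; proj₂)
open import Function.Bundles using (mk⇔)
open import Relation.Binary.PropositionalEquality
  using (refl; sym; trans; cong; subst; module ≡-Reasoning)
open import Relation.Binary.Definitions using (Maximum)
open import Relation.Binary.Structures using (IsEquivalence)
open import Algebra.Lattice.Bundles using (Lattice)
open import Algebra.Lattice.Structures using (IsDistributiveLattice)
import Algebra.Lattice.Properties.Lattice as LatticeProperties
import Relation.Binary.Lattice as OrderTheoretic

module BoundedDistributiveLatticeProperties
  {a : Level} {A : Set a} {_∧_ _∨_ : Op₂ A} {𝟎 𝟏 : A}
  (L : IsBDL _≡_ _∧_ _∨_ 𝟎 𝟏) where

  open IsBDL L
  open IsDistributiveLattice isDistributiveLattice
    using (isLattice; ∧-comm; ∧-absorbs-∨)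
  open ≡-Reasoning

  lattice : Lattice a a
  lattice = record { isLattice = isLattice }

  open LatticeProperties lattice public using (∨-idem)
  -- Here x ≤ y means x ≡ x ∧ y; the axioms of Defs state inequalities as x ∧ y ≡ x.
  open OrderTheoretic.Lattice (LatticeProperties.∨-∧-orderTheoreticLattice lattice) public
    using (_≤_; antisym; x∧y≤x; x∧y≤y; y≤x∨y; ∧-greatest)
    renaming (refl to ≤-refl; trans to ≤-trans)

  ∧-zeroˡ : ∀ x → 𝟎 ∧ x ≡ 𝟎
  ∧-zeroˡ x = begin
    𝟎 ∧ x        ≡⟨ cong (𝟎 ∧_) (proj₁ ∨-identity x) ⟨
    𝟎 ∧ (𝟎 ∨ x)  ≡⟨ ∧-absorbs-∨ 𝟎 x ⟩
    𝟎            ∎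

  ∧-zeroʳ : ∀ x → x ∧ 𝟎 ≡ 𝟎
  ∧-zeroʳ x = trans (∧-comm x 𝟎) (∧-zeroˡ x)

  𝟏-maximum : Maximum _≤_ 𝟏
  𝟏-maximum x = sym (proj₂ ∧-identity x)

  ≤-disjoint⇒≡𝟎 : ∀ {x y z} → x ≤ y → x ≤ z → y ∧ z ≡ 𝟎 → x ≡ 𝟎
  ≤-disjoint⇒≡𝟎 {x} x≤y x≤z y∧z≡𝟎 =
    antisym (subst (x ≤_) y∧z≡𝟎 (∧-greatest x≤y x≤z)) (sym (∧-zeroˡ x))

module HLatticeProperties
  {a : Level} {A : Set a} {_∧_ _∨_ _⇒_ : Op₂ A} {𝟎 𝟏 : A}
  (H : IsHLattice _≡_ _∧_ _∨_ _⇒_ 𝟎 𝟏) where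

  open IsHLattice H
  open BoundedDistributiveLatticeProperties isBDL

  x∧[x⇒y]≤y : ∀ x y → x ∧ (x ⇒ y) ≤ y
  x∧[x⇒y]≤y x y = sym (⇒-mp x y)

  ≤-mp : ∀ {t x y} → t ≤ x → t ≤ x ⇒ y → t ≤ y
  ≤-mp {x = x} {y} t≤x t≤x⇒y = ≤-trans (∧-greatest t≤x t≤x⇒y) (x∧[x⇒y]≤y x y)

  ⇒≡𝟏⇒≤ : ∀ {x y} → x ⇒ y ≡ 𝟏 → x ≤ y
  ⇒≡𝟏⇒≤ {x} x⇒y≡𝟏 = ≤-mp ≤-refl (subst (x ≤_) (sym x⇒y≡𝟏) (𝟏-maximum x))

  ⇒-chain-disjoint : ∀ {x y z w} → z ∧ w ≡ 𝟎 → ((x ⇒ y) ∧ (y ⇒ z)) ∧ (x ∧ w) ≡ 𝟎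
  ⇒-chain-disjoint {x} {y} {z} {w} z∧w≡𝟎 = ≤-disjoint⇒≡𝟎 t≤z t≤w z∧w≡𝟎
    where
    t≤x⇒y : ((x ⇒ y) ∧ (y ⇒ z)) ∧ (x ∧ w) ≤ x ⇒ y
    t≤x⇒y = ≤-trans (x∧y≤x _ _) (x∧y≤x _ _)
    t≤y⇒z : ((x ⇒ y) ∧ (y ⇒ z)) ∧ (x ∧ w) ≤ y ⇒ z
    t≤y⇒z = ≤-trans (x∧y≤x _ _) (x∧y≤y _ _)
    t≤x : ((x ⇒ y) ∧ (y ⇒ z)) ∧ (x ∧ w) ≤ x
    t≤x = ≤-trans (x∧y≤y _ _) (x∧y≤x x w)
    t≤w : ((x ⇒ y) ∧ (y ⇒ z)) ∧ (x ∧ w) ≤ w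
    t≤w = ≤-trans (x∧y≤y _ _) (x∧y≤y x w)
    t≤z : ((x ⇒ y) ∧ (y ⇒ z)) ∧ (x ∧ w) ≤ z
    t≤z = ≤-mp (≤-mp t≤x t≤x⇒y) t≤y⇒z

module SubresiduatedLatticeProperties
  {a : Level} {A : Set a} {_∧_ _∨_ _⇒_ : Op₂ A} {𝟎 𝟏 : A}
  (S : IsSubresiduatedLattice _≡_ _∧_ _∨_ _⇒_ 𝟎 𝟏) where

  open IsSubresiduatedLattice S
  open IsBDL isBDL using (∧-identity)
  open BoundedDistributiveLatticeProperties isBDL using (_≤_)
  open ≡-Reasoning

  ≤⇒⇒≡𝟏 : ∀ {x y} → x ≤ y → x ⇒ y ≡ 𝟏
  ≤⇒⇒≡𝟏 {x} {y} x≤y = begin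
    x ⇒ y              ≡⟨ proj₁ ∧-identity (x ⇒ y) ⟨
    𝟏 ∧ (x ⇒ y)        ≡⟨ cong (_∧ (x ⇒ y)) (ax4 x) ⟨
    (x ⇒ x) ∧ (x ⇒ y)  ≡⟨ ax2 x y x ⟨
    x ⇒ (x ∧ y)        ≡⟨ cong (x ⇒_) x≤y ⟨
    x ⇒ x              ≡⟨ ax4 x ⟩
    𝟏                  ∎

module KProperties
  {a : Level} {A : Set a} {_∧_ _∨_ _⇒_ : Op₂ A} {𝟎 𝟏 : A}
  (H : IsHLattice _≡_ _∧_ _∨_ _⇒_ 𝟎 𝟏) where

  open K H
  open IsHLattice H
  open IsBDL isBDL
  open IsDistributiveLattice isDistributiveLattice hiding (refl; sym; trans)
  open BoundedDistributiveLatticeProperties isBDL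
  open HLatticeProperties H

  ≈-isEquivalence : IsEquivalence _≈_
  ≈-isEquivalence = record
    { refl  = λ { {(_ , _) , _} → refl , refl }
    ; sym   = λ { {(_ , _) , _} {(_ , _) , _} (p , q) → sym p , sym q }
    ; trans = λ { {(_ , _) , _} {(_ , _) , _} {(_ , _) , _} (p , q) (r , s) → trans p r , trans q s }
    }

  K-isDistributiveLattice : IsDistributiveLattice _≈_ _∨K_ _∧K_
  K-isDistributiveLattice = record
    { isLattice = record
      { isEquivalence = ≈-isEquivalence
      ; ∨-comm  = λ { ((a , b) , _) ((c , d) , _) → ∨-comm a c , ∧-comm b d }
      ; ∨-assoc = λ { ((a , b) , _) ((c , d) , _) ((e , f) , _) → ∨-assoc a c e , ∧-assoc b d f }
      ; ∨-cong  = λ { {(_ , _) , _} {(_ , _) , _} {(_ , _) , _} {(_ , _) , _}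
                      (refl , refl) (refl , refl) → refl , refl }
      ; ∧-comm  = λ { ((a , b) , _) ((c , d) , _) → ∧-comm a c , ∨-comm b d }
      ; ∧-assoc = λ { ((a , b) , _) ((c , d) , _) ((e , f) , _) → ∧-assoc a c e , ∨-assoc b d f }
      ; ∧-cong  = λ { {(_ , _) , _} {(_ , _) , _} {(_ , _) , _} {(_ , _) , _}
                      (refl , refl) (refl , refl) → refl , refl }
      ; absorptive =
          (λ { ((a , b) , _) ((c , d) , _) → ∨-absorbs-∧ a c , ∧-absorbs-∨ b d }) ,
          (λ { ((a , b) , _) ((c , d) , _) → ∧-absorbs-∨ a c , ∨-absorbs-∧ b d })
      }
    ; ∨-distrib-∧ =
        (λ { ((a , b) , _) ((c , d) , _) ((e , f) , _) → ∨-distribˡ-∧ a c e , ∧-distribˡ-∨ b d f }) ,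
        (λ { ((a , b) , _) ((c , d) , _) ((e , f) , _) → ∨-distribʳ-∧ a c e , ∧-distribʳ-∨ b d f })
    ; ∧-distrib-∨ =
        (λ { ((a , b) , _) ((c , d) , _) ((e , f) , _) → ∧-distribˡ-∨ a c e , ∨-distribˡ-∧ b d f }) ,
        (λ { ((a , b) , _) ((c , d) , _) ((e , f) , _) → ∧-distribʳ-∨ a c e , ∨-distribʳ-∧ b d f })
    }

  K-isBDL : IsBDL _≈_ _∧K_ _∨K_ 𝟎K 𝟏K
  K-isBDL = record
    { isDistributiveLattice = K-isDistributiveLattice
    ; ∨-identity = (λ { ((a , b) , _) → proj₁ ∨-identity a , proj₁ ∧-identity b })
                 , (λ { ((a , b) , _) → proj₂ ∨-identity a , proj₂ ∧-identity b })
    ; ∧-identity = (λ { ((a , b) , _) → proj₁ ∧-identity a , proj₁ ∨-identity b })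
                 , (λ { ((a , b) , _) → proj₂ ∧-identity a , proj₂ ∨-identity b })
    }

  K-isKleene : IsKleene _≈_ _∧K_ _∨K_ ∼K 𝟎K 𝟏K
  K-isKleene = record
    { isBDL      = K-isBDL
    ; ∼-invol    = λ { ((_ , _) , _) → refl , refl }
    ; ∼-deMorgan = λ { ((_ , _) , _) ((_ , _) , _) → refl , refl }
    ; kleene     = λ { ((a , b) , a∧b≡𝟎) ((c , d) , c∧d≡𝟎) →
        trans (cong (_∧ (c ∨ d)) a∧b≡𝟎) (trans (∧-zeroˡ (c ∨ d)) (sym a∧b≡𝟎)) ,
        trans (cong ((b ∨ a) ∨_) (trans (∧-comm d c) c∧d≡𝟎)) (proj₂ ∨-identity (b ∨ a)) }
    }

  isSubresiduated⇒K-isSRN : IsSubresiduatedLattice _≡_ _∧_ _∨_ _⇒_ 𝟎 𝟏 →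
                            IsSRN _≈_ _∧K_ _∨K_ _⇒K_ ∼K 𝟎K 𝟏K
  isSubresiduated⇒K-isSRN S = record
    { isKleene = K-isKleene
    ; n1 = λ { ((a , _) , _) ((c , _) , _) ((e , f) , _) → ax1 a c e , ∧-distribʳ-∨ f a c }
    ; n2 = λ { ((a , b) , _) ((c , d) , _) ((e , _) , _) → ax2 a c e , ∧-distribˡ-∨ e b d }
    ; n3 = λ { ((a , _) , _) ((c , _) , _) ((e , _) , e∧f≡𝟎) →
        ≤⇒⇒≡𝟏 (sym (ax3 a c e)) , ⇒-chain-disjoint e∧f≡𝟎 }
    ; n4 = λ { ((a , _) , a∧b≡𝟎) → ax4 a , a∧b≡𝟎 }
    ; n5 = λ { ((a , b) , _) ((c , _) , _) →
        sym (∧-greatest (x∧y≤x a (a ⇒ c)) (≤-trans (x∧[x⇒y]≤y a c) (y≤x∨y b c))) ,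
        ∨-idem _ }
    ; n6 = λ { ((a , _) , _) ((c , d) , _) ((e , _) , _) →
        ax6 a c e , trans (cong ((a ∧ d) ∨_) (∧-comm e (a ∧ d))) (∨-absorbs-∧ (a ∧ d) e) }
    -- The second coordinates of (7) and (8) vanish because x ∧ ∼y and x → y lie in K(A).
    ; n7 = λ { x@((a , _) , _) y@((_ , d) , _) → ax4 (a ∧ d) , proj₂ (x ∧K ∼K y) }
    ; n8 = λ { x@((a , _) , _) y@((c , d) , _) →
        ax4 (a ∧ d) , trans (∧-comm (a ∧ d) (a ⇒ c)) (proj₂ (x ⇒K y)) }
    }
    where
    open IsSubresiduatedLattice S using (ax1; ax2; ax3; ax4; ax6)
    open SubresiduatedLatticeProperties S

  ι : A → Carrier
  ι x = (x , 𝟎) , ∧-zeroʳ x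

  K-isSRN⇒isSubresiduated : IsSRN _≈_ _∧K_ _∨K_ _⇒K_ ∼K 𝟎K 𝟏K →
                            IsSubresiduatedLattice _≡_ _∧_ _∨_ _⇒_ 𝟎 𝟏
  K-isSRN⇒isSubresiduated N = record
    { isBDL = isBDL
    ; ax1 = λ x y z → proj₁ (n1 (ι x) (ι y) (ι z))
    ; ax2 = λ x y z → proj₁ (n2 (ι x) (ι y) (ι z))
    ; ax3 = λ x y z → sym (⇒≡𝟏⇒≤ (proj₁ (n3 (ι x) (ι y) (ι z))))
    ; ax4 = ⇒-refl
    ; ax5 = ⇒-mp
    ; ax6 = λ x y z → proj₁ (n6 (ι x) (ι y) (ι z))
    }
    where open IsSRN N

proposition50 : ∀ {a : Level} {A : Set a} {_∧_ _∨_ _⇒_ : Op₂ A} {𝟎 𝟏 : A}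
                (H : IsHLattice _≡_ _∧_ _∨_ _⇒_ 𝟎 𝟏) →
                IsSubresiduatedLattice _≡_ _∧_ _∨_ _⇒_ 𝟎 𝟏
                ⇔ IsSRN (K._≈_ H) (K._∧K_ H) (K._∨K_ H) (K._⇒K_ H) (K.∼K H) (K.𝟎K H) (K.𝟏K H)
proposition50 H = mk⇔ isSubresiduated⇒K-isSRN K-isSRN⇒isSubresiduated
  where open KProperties H
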